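{- $\mathsf{IQ}^{+}$ and $\mathsf{IQ}^{++}$ are mutually interpretable.
   Context: $\mathsf{IQ}$ is the theory in language $\{0,\mathrm S,+,\times,\leq\}$ with axioms $\forall xy\,[x\neq y\to\mathrm Sx\neq\mathrm Sy]$, $\forall x\,[\mathrm Sx\neq 0]$, $\forall x\,[x+0=x]$, $\forall xy\,[x+\mathrm Sy=\mathrm S(x+y)]$, $\forall x\,[x\times 0=0]$, $\forall xy\,[x\times\mathrm Sy=x\times y+x]$, and the schema $\forall x\,[x\leq\overline{n}\leftrightarrow\bigvee_{k\leq n}x=\overline{k}]$ for each natural number $n$ (numerals $\overline0\equiv0$, $\overline{n+1}\equiv\mathrm S\overline n$). $\mathsf{IQ}^{+}$ is $\mathsf{IQ}$ extended with $\forall xyz\,[(x+y)+z=x+(y+z)]$, $\forall xyz\,[x(y+z)=xy+xz]$ and $\forall xyz\,[(xy)z=x(yz)]$. $\mathsf{IQ}^{++}$ is $\mathsf{IQ}^{+}$ extended with $\forall x\,[0\leq x]$ and $\forall xy\,[x\leq y\to\mathrm Sx\leq\mathrm Sy]$. Interpretability: an $\mathcal L_1$-theory $S$ is interpretable in an $\mathcal L_2$-theory $T$ if there is a (possibly multi-dimensional, parameter-free, one-piece) relative translation (domain formula, formulas for relation symbols including equality, graphs of function symbols, constants; quantifiers relativized to the domain) such that $T$ proves nonemptiness of the domain, totality and uniqueness of the translated functions and constants on the domain, and the translations of all axioms of $S$ (plus equality axioms if equality is not translated as equality). Mutual interpretability means each is interpretable in the other. -}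

module Defs where

open import Data.Nat using (ℕ; zero; suc; _+_)
open import Data.Fin using (Fin; zero; suc; splitAt; _↑ˡ_; _↑ʳ_)
open import Data.Sum using ([_,_]′)
open import Data.List using (List; []; _∷_; map)
open import Data.List.Membership.Propositional using (_∈_)
open import Data.List.Relation.Unary.All using (All)
open import Data.Product using (Σ; _×_)

infixr 6 _⊕_
infixr 7 _⊗_
infix  4 _≐_ _≼_
infixr 3 _∧'_
infixr 2 _∨'_
infixr 1 _⇒_

data Tm (n : ℕ) : Set where
  var : Fin n → Tm n
  𝟎   : Tm n
  𝐒   : Tm n → Tm n
  _⊕_ : Tm n → Tm n → Tm n
  _⊗_ : Tm n → Tm n → Tm n

data Fm (n : ℕ) : Set where
  _≐_  : Tm n → Tm n → Fm n
  _≼_  : Tm n → Tm n → Fm n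
  ⊥'   : Fm n
  _⇒_  : Fm n → Fm n → Fm n
  _∧'_ : Fm n → Fm n → Fm n
  _∨'_ : Fm n → Fm n → Fm n
  ∀'   : Fm (suc n) → Fm n
  ∃'   : Fm (suc n) → Fm n

¬' : ∀ {n} → Fm n → Fm n
¬' φ = φ ⇒ ⊥'

_⇔_ : ∀ {n} → Fm n → Fm n → Fm n
φ ⇔ ψ = (φ ⇒ ψ) ∧' (ψ ⇒ φ)

Sentence : Set
Sentence = Fm 0

liftR : ∀ {m n} → (Fin m → Fin n) → Fin (suc m) → Fin (suc n)
liftR ρ zero    = zero
liftR ρ (suc i) = suc (ρ i)

renT : ∀ {m n} → (Fin m → Fin n) → Tm m → Tm n
renT ρ (var i) = var (ρ i)
renT ρ 𝟎       = 𝟎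
renT ρ (𝐒 t)   = 𝐒 (renT ρ t)
renT ρ (t ⊕ s) = renT ρ t ⊕ renT ρ s
renT ρ (t ⊗ s) = renT ρ t ⊗ renT ρ s

renF : ∀ {m n} → (Fin m → Fin n) → Fm m → Fm n
renF ρ (t ≐ s)  = renT ρ t ≐ renT ρ s
renF ρ (t ≼ s)  = renT ρ t ≼ renT ρ s
renF ρ ⊥'       = ⊥'
renF ρ (φ ⇒ ψ)  = renF ρ φ ⇒ renF ρ ψ
renF ρ (φ ∧' ψ) = renF ρ φ ∧' renF ρ ψ
renF ρ (φ ∨' ψ) = renF ρ φ ∨' renF ρ ψ
renF ρ (∀' φ)   = ∀' (renF (liftR ρ) φ)
renF ρ (∃' φ)   = ∃' (renF (liftR ρ) φ)

liftS : ∀ {m n} → (Fin m → Tm n) → Fin (suc m) → Tm (suc n)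
liftS σ zero    = var zero
liftS σ (suc i) = renT suc (σ i)

subT : ∀ {m n} → (Fin m → Tm n) → Tm m → Tm n
subT σ (var i) = σ i
subT σ 𝟎       = 𝟎
subT σ (𝐒 t)   = 𝐒 (subT σ t)
subT σ (t ⊕ s) = subT σ t ⊕ subT σ s
subT σ (t ⊗ s) = subT σ t ⊗ subT σ s

subF : ∀ {m n} → (Fin m → Tm n) → Fm m → Fm n
subF σ (t ≐ s)  = subT σ t ≐ subT σ s
subF σ (t ≼ s)  = subT σ t ≼ subT σ s
subF σ ⊥'       = ⊥'
subF σ (φ ⇒ ψ)  = subF σ φ ⇒ subF σ ψ
subF σ (φ ∧' ψ) = subF σ φ ∧' subF σ ψ
subF σ (φ ∨' ψ) = subF σ φ ∨' subF σ ψ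
subF σ (∀' φ)   = ∀' (subF (liftS σ) φ)
subF σ (∃' φ)   = ∃' (subF (liftS σ) φ)

_[_] : ∀ {n} → Fm (suc n) → Tm n → Fm n
φ [ t ] = subF σ φ
  where
  σ : Fin (suc _) → Tm _
  σ zero    = t
  σ (suc i) = var i

wkF : ∀ {n} → Fm n → Fm (suc n)
wkF = renF suc

infix 0 _⊢_

data _⊢_ {n : ℕ} (Γ : List (Fm n)) : Fm n → Set where
  hyp   : ∀ {φ} → φ ∈ Γ → Γ ⊢ φ
  ⊥E    : ∀ {φ} → Γ ⊢ ⊥' → Γ ⊢ φ
  raa   : ∀ {φ} → (¬' φ ∷ Γ) ⊢ ⊥' → Γ ⊢ φ
  ⇒I    : ∀ {φ ψ} → (φ ∷ Γ) ⊢ ψ → Γ ⊢ φ ⇒ ψ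
  ⇒E    : ∀ {φ ψ} → Γ ⊢ φ ⇒ ψ → Γ ⊢ φ → Γ ⊢ ψ
  ∧I    : ∀ {φ ψ} → Γ ⊢ φ → Γ ⊢ ψ → Γ ⊢ φ ∧' ψ
  ∧E₁   : ∀ {φ ψ} → Γ ⊢ φ ∧' ψ → Γ ⊢ φ
  ∧E₂   : ∀ {φ ψ} → Γ ⊢ φ ∧' ψ → Γ ⊢ ψ
  ∨I₁   : ∀ {φ ψ} → Γ ⊢ φ → Γ ⊢ φ ∨' ψ
  ∨I₂   : ∀ {φ ψ} → Γ ⊢ ψ → Γ ⊢ φ ∨' ψ
  ∨E    : ∀ {φ ψ χ} → Γ ⊢ φ ∨' ψ → (φ ∷ Γ) ⊢ χ → (ψ ∷ Γ) ⊢ χ → Γ ⊢ χ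
  ∀I    : ∀ {φ} → map wkF Γ ⊢ φ → Γ ⊢ ∀' φ
  ∀E    : ∀ {φ} → Γ ⊢ ∀' φ → (t : Tm n) → Γ ⊢ φ [ t ]
  ∃I    : ∀ {φ} (t : Tm n) → Γ ⊢ φ [ t ] → Γ ⊢ ∃' φ
  ∃E    : ∀ {φ ψ} → Γ ⊢ ∃' φ → (φ ∷ map wkF Γ) ⊢ wkF ψ → Γ ⊢ ψ
  ≐refl : ∀ {t} → Γ ⊢ t ≐ t
  ≐subst : ∀ {φ s t} → Γ ⊢ s ≐ t → Γ ⊢ φ [ s ] → Γ ⊢ φ [ t ]

Theory : Set₁
Theory = Sentence → Set

infix 0 _⊩_
_⊩_ : Theory → Sentence → Set
T ⊩ φ = Σ (List Sentence) (λ Γ → All T Γ × (Γ ⊢ φ))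

num : ∀ {n} → ℕ → Tm n
num zero    = 𝟎
num (suc k) = 𝐒 (num k)

bigOr : ∀ {m} → Tm m → ℕ → Fm m
bigOr t zero    = t ≐ num 0
bigOr t (suc n) = bigOr t n ∨' (t ≐ num (suc n))

private
  v0 : ∀ {n} → Tm (suc n)
  v0 = var zero
  v1 : ∀ {n} → Tm (suc (suc n))
  v1 = var (suc zero)
  v2 : ∀ {n} → Tm (suc (suc (suc n)))
  v2 = var (suc (suc zero))
  v3 : ∀ {n} → Tm (suc (suc (suc (suc n))))
  v3 = var (suc (suc (suc zero)))

-- In ∀' ∀' φ the first bound variable (x) is v1 and the second (y) is v0.
data IQ : Theory where
  iq1 : IQ (∀' (∀' (¬' (v1 ≐ v0) ⇒ ¬' (𝐒 v1 ≐ 𝐒 v0))))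
  iq2 : IQ (∀' (¬' (𝐒 v0 ≐ 𝟎)))
  iq3 : IQ (∀' (v0 ⊕ 𝟎 ≐ v0))
  iq4 : IQ (∀' (∀' (v1 ⊕ 𝐒 v0 ≐ 𝐒 (v1 ⊕ v0))))
  iq5 : IQ (∀' (v0 ⊗ 𝟎 ≐ 𝟎))
  iq6 : IQ (∀' (∀' (v1 ⊗ 𝐒 v0 ≐ (v1 ⊗ v0) ⊕ v1)))
  iq≤ : (n : ℕ) → IQ (∀' ((v0 ≼ num n) ⇔ bigOr v0 n))

-- ∀xyz: x is v2, y is v1, z is v0
data IQ⁺ : Theory where
  base    : ∀ {φ} → IQ φ → IQ⁺ φ
  +assoc  : IQ⁺ (∀' (∀' (∀' ((v2 ⊕ v1) ⊕ v0 ≐ v2 ⊕ (v1 ⊕ v0)))))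
  distrib : IQ⁺ (∀' (∀' (∀' (v2 ⊗ (v1 ⊕ v0) ≐ (v2 ⊗ v1) ⊕ (v2 ⊗ v0)))))
  *assoc  : IQ⁺ (∀' (∀' (∀' ((v2 ⊗ v1) ⊗ v0 ≐ v2 ⊗ (v1 ⊗ v0)))))

data IQ⁺⁺ : Theory where
  base  : ∀ {φ} → IQ⁺ φ → IQ⁺⁺ φ
  0≤    : IQ⁺⁺ (∀' (𝟎 ≼ v0))
  ≤mono : IQ⁺⁺ (∀' (∀' (v1 ≼ v0 ⇒ 𝐒 v1 ≼ 𝐒 v0)))

data EqAx : Theory where
  e-refl : EqAx (∀' (v0 ≐ v0))
  -- ∀ x₁ y₁ x₂ y₂ (x₁ = y₁ → x₂ = y₂ → …): x₁ = v3, y₁ = v2, x₂ = v1, y₂ = v0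
  e-≐    : EqAx (∀' (∀' (∀' (∀' (v3 ≐ v2 ⇒ v1 ≐ v0 ⇒ v3 ≐ v1 ⇒ v2 ≐ v0)))))
  e-≼    : EqAx (∀' (∀' (∀' (∀' (v3 ≐ v2 ⇒ v1 ≐ v0 ⇒ v3 ≼ v1 ⇒ v2 ≼ v0)))))
  e-S    : EqAx (∀' (∀' (v1 ≐ v0 ⇒ 𝐒 v1 ≐ 𝐒 v0)))
  e-+    : EqAx (∀' (∀' (∀' (∀' (v3 ≐ v2 ⇒ v1 ≐ v0 ⇒ v3 ⊕ v1 ≐ v2 ⊕ v0)))))
  e-*    : EqAx (∀' (∀' (∀' (∀' (v3 ≐ v2 ⇒ v1 ≐ v0 ⇒ v3 ⊗ v1 ≐ v2 ⊗ v0)))))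

∀ⁿ : ∀ {m} (k : ℕ) → Fm (k + m) → Fm m
∀ⁿ zero    φ = φ
∀ⁿ (suc k) φ = ∀ⁿ k (∀' φ)

∃ⁿ : ∀ {m} (k : ℕ) → Fm (k + m) → Fm m
∃ⁿ zero    φ = φ
∃ⁿ (suc k) φ = ∃ⁿ k (∃' φ)

-- a translation of the language {0,S,+,×,≤,=} of dimension d:
-- formulas whose free variables are d-blocks
record Transl (d : ℕ) : Set where
  field
    δ  : Fm d
    Eq : Fm (d + d)
    Le : Fm (d + d)
    Zr : Fm d                -- graph of 0:     x = 0
    Sc : Fm (d + d)          -- graph of S:     S x = y
    Ad : Fm (d + (d + d))    -- graph of +:     x + y = z
    Mu : Fm (d + (d + d))    -- graph of ×:     x × y = z

module Translation {d : ℕ} (τ : Transl d) where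
  open Transl τ

  Block : ℕ → Set
  Block m = Fin d → Fin m

  new : ∀ {m} → Block (d + m)
  new {m} j = j ↑ˡ m

  wk : ∀ {m} → Block m → Block (d + m)
  wk b j = d ↑ʳ b j

  ∀ᵇ : ∀ {m} → Fm (d + m) → Fm m
  ∀ᵇ = ∀ⁿ d

  ∃ᵇ : ∀ {m} → Fm (d + m) → Fm m
  ∃ᵇ = ∃ⁿ d

  inst1 : ∀ {m} → Fm d → Block m → Fm m
  inst1 φ a = renF a φ

  inst2 : ∀ {m} → Fm (d + d) → Block m → Block m → Fm m
  inst2 φ a b = renF (λ i → [ a , b ]′ (splitAt d i)) φ

  inst3 : ∀ {m} → Fm (d + (d + d)) → Block m → Block m → Block m → Fm m
  inst3 φ a b c = renF (λ i → [ a , (λ k → [ b , c ]′ (splitAt d k)) ]′ (splitAt d i)) φ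

  Dom : ∀ {m} → Block m → Fm m
  Dom = inst1 δ

  -- Ev t env o :  "the value of term t (variables given by env) is the block o"
  Ev : ∀ {n m} → Tm n → (Fin n → Block m) → Block m → Fm m
  Ev (var i) env o = inst2 Eq (env i) o
  Ev 𝟎       env o = inst1 Zr o
  Ev (𝐒 t)   env o =
    ∃ᵇ (Dom new ∧' Ev t (λ i → wk (env i)) new ∧' inst2 Sc new (wk o))
  Ev (t ⊕ s) env o =
    ∃ᵇ (Dom new ∧' ∃ᵇ (Dom new
      ∧' Ev t (λ i → wk (wk (env i))) (wk new)
      ∧' Ev s (λ i → wk (wk (env i))) new
      ∧' inst3 Ad (wk new) new (wk (wk o))))
  Ev (t ⊗ s) env o =
    ∃ᵇ (Dom new ∧' ∃ᵇ (Dom new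
      ∧' Ev t (λ i → wk (wk (env i))) (wk new)
      ∧' Ev s (λ i → wk (wk (env i))) new
      ∧' inst3 Mu (wk new) new (wk (wk o))))

  ext : ∀ {n m} → (Fin n → Block m) → Fin (suc n) → Block (d + m)
  ext env zero    = new
  ext env (suc i) = wk (env i)

  atom : ∀ {n m} → Fm (d + d) → Tm n → Tm n → (Fin n → Block m) → Fm m
  atom R t s env =
    ∃ᵇ (Dom new ∧' ∃ᵇ (Dom new
      ∧' Ev t (λ i → wk (wk (env i))) (wk new)
      ∧' Ev s (λ i → wk (wk (env i))) new
      ∧' inst2 R (wk new) new))

  tr : ∀ {n m} → Fm n → (Fin n → Block m) → Fm m
  tr (t ≐ s)  env = atom Eq t s env
  tr (t ≼ s)  env = atom Le t s env
  tr ⊥'       env = ⊥'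
  tr (φ ⇒ ψ)  env = tr φ env ⇒ tr ψ env
  tr (φ ∧' ψ) env = tr φ env ∧' tr ψ env
  tr (φ ∨' ψ) env = tr φ env ∨' tr ψ env
  tr (∀' φ)   env = ∀ᵇ (Dom new ⇒ tr φ (ext env))
  tr (∃' φ)   env = ∃ᵇ (Dom new ∧' tr φ (ext env))

  trS : Sentence → Sentence
  trS φ = tr φ (λ ())

  domNonempty : Sentence
  domNonempty = ∃ᵇ (Dom new)

  zeroTotal : Sentence
  zeroTotal = ∃ᵇ (Dom new ∧' inst1 Zr new)

  zeroUnique : Sentence
  zeroUnique = ∀ᵇ (∀ᵇ (Dom (wk new) ∧' Dom new ∧' inst1 Zr (wk new) ∧' inst1 Zr new
                  ⇒ inst2 Eq (wk new) new))

  unTotal : Fm (d + d) → Sentence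
  unTotal G = ∀ᵇ (Dom new ⇒ ∃ᵇ (Dom new ∧' inst2 G (wk new) new))

  unUnique : Fm (d + d) → Sentence
  unUnique G = ∀ᵇ (∀ᵇ (∀ᵇ (
      Dom (wk (wk new)) ∧' Dom (wk new) ∧' Dom new
      ∧' inst2 G (wk (wk new)) (wk new) ∧' inst2 G (wk (wk new)) new
      ⇒ inst2 Eq (wk new) new)))

  binTotal : Fm (d + (d + d)) → Sentence
  binTotal G = ∀ᵇ (∀ᵇ (Dom (wk new) ∧' Dom new
      ⇒ ∃ᵇ (Dom new ∧' inst3 G (wk (wk new)) (wk new) new)))

  binUnique : Fm (d + (d + d)) → Sentence
  binUnique G = ∀ᵇ (∀ᵇ (∀ᵇ (∀ᵇ (
      Dom (wk (wk (wk new))) ∧' Dom (wk (wk new)) ∧' Dom (wk new) ∧' Dom new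
      ∧' inst3 G (wk (wk (wk new))) (wk (wk new)) (wk new)
      ∧' inst3 G (wk (wk (wk new))) (wk (wk new)) new
      ⇒ inst2 Eq (wk new) new))))

record IsInterpretation {d : ℕ} (S T : Theory) (τ : Transl d) : Set where
  open Transl τ
  open Translation τ
  field
    dom     : T ⊩ domNonempty
    zeroTot : T ⊩ zeroTotal
    zeroUni : T ⊩ zeroUnique
    sucTot  : T ⊩ unTotal Sc
    sucUni  : T ⊩ unUnique Sc
    addTot  : T ⊩ binTotal Ad
    addUni  : T ⊩ binUnique Ad
    mulTot  : T ⊩ binTotal Mu
    mulUni  : T ⊩ binUnique Mu
    eqAxioms : ∀ φ → EqAx φ → T ⊩ trS φ
    axioms   : ∀ φ → S φ → T ⊩ trS φ

Interpretable : Theory → Theory → Set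
Interpretable S T = Σ ℕ (λ k → Σ (Transl (suc k)) (λ τ → IsInterpretation S T τ))

MutuallyInterpretable : Theory → Theory → Set
MutuallyInterpretable S T = Interpretable S T × Interpretable T S

{-# OPTIONS --safe #-}
module Submission where

-- Both interpretations are one-dimensional and translate 0, S, +, × and = by
-- themselves.  As IQ⁺ ⊆ IQ⁺⁺, one direction is the identity.  For the other,
-- x ≤ y is read as "if y is hereditarily tame then x ≤ y", where z is tame if ≤
-- has at z a few closure properties (among them 0 ≤ z and x ≤ z → Sx ≤ Sz), and
-- y is hereditarily tame if y ≤ y and everything ≤ y is tame.  Under this
-- reading 0 ≤ x and x ≤ y → Sx ≤ Sy become pure logic, while every numeral is
-- hereditarily tame already in IQ, so on numerals the new order agrees with ≤
-- and the ≤-schema of IQ survives.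

open import Defs
open import Data.Nat using (ℕ; zero; suc; _+_)
open import Data.Fin using (Fin; zero; suc)
open import Data.List using (List; []; _∷_; map; _++_)
open import Data.List.Properties using (map-∘; map-cong)
open import Data.List.Membership.Propositional.Properties using (∈-map⁺)
open import Data.List.Relation.Binary.Subset.Propositional using (_⊆_)
open import Data.List.Relation.Binary.Subset.Propositional.Properties
  using (⊆-refl; ⊆-trans; ⊆-reflexive; map⁺; ∷⁺ʳ; xs⊆x∷xs; xs⊆xs++ys; xs⊆ys++xs)
open import Data.List.Relation.Unary.Any using (here; there)
open import Data.List.Relation.Unary.All using ([]; _∷_)
open import Data.List.Relation.Unary.All.Properties using (++⁺)
open import Data.Product using (_,_)
open import Relation.Binary.PropositionalEquality hiding ([_])

Ren : ℕ → ℕ → Set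
Ren m n = Fin m → Fin n

Sub : ℕ → ℕ → Set
Sub m n = Fin m → Tm n

wkT : ∀ {n} → Tm n → Tm (suc n)
wkT = renT suc

sub₀ : ∀ {n} → Tm n → Sub (suc n) n
sub₀ t zero    = t
sub₀ t (suc i) = var i

liftR-cong : ∀ {m n} {ρ ρ' : Ren m n} → (∀ i → ρ i ≡ ρ' i) → ∀ i → liftR ρ i ≡ liftR ρ' i
liftR-cong e zero    = refl
liftR-cong e (suc i) = cong suc (e i)

renT-cong : ∀ {m n} {ρ ρ' : Ren m n} → (∀ i → ρ i ≡ ρ' i) → ∀ t → renT ρ t ≡ renT ρ' t
renT-cong e (var i) = cong var (e i)
renT-cong e 𝟎       = refl
renT-cong e (𝐒 t)   = cong 𝐒 (renT-cong e t)
renT-cong e (t ⊕ s) = cong₂ _⊕_ (renT-cong e t) (renT-cong e s)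
renT-cong e (t ⊗ s) = cong₂ _⊗_ (renT-cong e t) (renT-cong e s)

renF-cong : ∀ {m n} {ρ ρ' : Ren m n} → (∀ i → ρ i ≡ ρ' i) → ∀ φ → renF ρ φ ≡ renF ρ' φ
renF-cong e (t ≐ s)  = cong₂ _≐_ (renT-cong e t) (renT-cong e s)
renF-cong e (t ≼ s)  = cong₂ _≼_ (renT-cong e t) (renT-cong e s)
renF-cong e ⊥'       = refl
renF-cong e (φ ⇒ ψ)  = cong₂ _⇒_ (renF-cong e φ) (renF-cong e ψ)
renF-cong e (φ ∧' ψ) = cong₂ _∧'_ (renF-cong e φ) (renF-cong e ψ)
renF-cong e (φ ∨' ψ) = cong₂ _∨'_ (renF-cong e φ) (renF-cong e ψ)
renF-cong e (∀' φ)   = cong ∀' (renF-cong (liftR-cong e) φ)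
renF-cong e (∃' φ)   = cong ∃' (renF-cong (liftR-cong e) φ)

liftS-cong : ∀ {m n} {σ σ' : Sub m n} → (∀ i → σ i ≡ σ' i) → ∀ i → liftS σ i ≡ liftS σ' i
liftS-cong e zero    = refl
liftS-cong e (suc i) = cong wkT (e i)

subT-cong : ∀ {m n} {σ σ' : Sub m n} → (∀ i → σ i ≡ σ' i) → ∀ t → subT σ t ≡ subT σ' t
subT-cong e (var i) = e i
subT-cong e 𝟎       = refl
subT-cong e (𝐒 t)   = cong 𝐒 (subT-cong e t)
subT-cong e (t ⊕ s) = cong₂ _⊕_ (subT-cong e t) (subT-cong e s)
subT-cong e (t ⊗ s) = cong₂ _⊗_ (subT-cong e t) (subT-cong e s)

subF-cong : ∀ {m n} {σ σ' : Sub m n} → (∀ i → σ i ≡ σ' i) → ∀ φ → subF σ φ ≡ subF σ' φ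
subF-cong e (t ≐ s)  = cong₂ _≐_ (subT-cong e t) (subT-cong e s)
subF-cong e (t ≼ s)  = cong₂ _≼_ (subT-cong e t) (subT-cong e s)
subF-cong e ⊥'       = refl
subF-cong e (φ ⇒ ψ)  = cong₂ _⇒_ (subF-cong e φ) (subF-cong e ψ)
subF-cong e (φ ∧' ψ) = cong₂ _∧'_ (subF-cong e φ) (subF-cong e ψ)
subF-cong e (φ ∨' ψ) = cong₂ _∨'_ (subF-cong e φ) (subF-cong e ψ)
subF-cong e (∀' φ)   = cong ∀' (subF-cong (liftS-cong e) φ)
subF-cong e (∃' φ)   = cong ∃' (subF-cong (liftS-cong e) φ)

renT-renT : ∀ {k m n} (ρ : Ren m n) (ρ' : Ren k m) t → renT ρ (renT ρ' t) ≡ renT (λ i → ρ (ρ' i)) t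
renT-renT ρ ρ' (var i) = refl
renT-renT ρ ρ' 𝟎       = refl
renT-renT ρ ρ' (𝐒 t)   = cong 𝐒 (renT-renT ρ ρ' t)
renT-renT ρ ρ' (t ⊕ s) = cong₂ _⊕_ (renT-renT ρ ρ' t) (renT-renT ρ ρ' s)
renT-renT ρ ρ' (t ⊗ s) = cong₂ _⊗_ (renT-renT ρ ρ' t) (renT-renT ρ ρ' s)

liftR-liftR : ∀ {k m n} (ρ : Ren m n) (ρ' : Ren k m) i → liftR ρ (liftR ρ' i) ≡ liftR (λ j → ρ (ρ' j)) i
liftR-liftR ρ ρ' zero    = refl
liftR-liftR ρ ρ' (suc i) = refl

renF-renF : ∀ {k m n} (ρ : Ren m n) (ρ' : Ren k m) φ → renF ρ (renF ρ' φ) ≡ renF (λ i → ρ (ρ' i)) φ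
renF-renF ρ ρ' (t ≐ s)  = cong₂ _≐_ (renT-renT ρ ρ' t) (renT-renT ρ ρ' s)
renF-renF ρ ρ' (t ≼ s)  = cong₂ _≼_ (renT-renT ρ ρ' t) (renT-renT ρ ρ' s)
renF-renF ρ ρ' ⊥'       = refl
renF-renF ρ ρ' (φ ⇒ ψ)  = cong₂ _⇒_ (renF-renF ρ ρ' φ) (renF-renF ρ ρ' ψ)
renF-renF ρ ρ' (φ ∧' ψ) = cong₂ _∧'_ (renF-renF ρ ρ' φ) (renF-renF ρ ρ' ψ)
renF-renF ρ ρ' (φ ∨' ψ) = cong₂ _∨'_ (renF-renF ρ ρ' φ) (renF-renF ρ ρ' ψ)
renF-renF ρ ρ' (∀' φ)   = cong ∀' (trans (renF-renF (liftR ρ) (liftR ρ') φ) (renF-cong (liftR-liftR ρ ρ') φ))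
renF-renF ρ ρ' (∃' φ)   = cong ∃' (trans (renF-renF (liftR ρ) (liftR ρ') φ) (renF-cong (liftR-liftR ρ ρ') φ))

subT-renT : ∀ {k m n} (σ : Sub m n) (ρ : Ren k m) t → subT σ (renT ρ t) ≡ subT (λ i → σ (ρ i)) t
subT-renT σ ρ (var i) = refl
subT-renT σ ρ 𝟎       = refl
subT-renT σ ρ (𝐒 t)   = cong 𝐒 (subT-renT σ ρ t)
subT-renT σ ρ (t ⊕ s) = cong₂ _⊕_ (subT-renT σ ρ t) (subT-renT σ ρ s)
subT-renT σ ρ (t ⊗ s) = cong₂ _⊗_ (subT-renT σ ρ t) (subT-renT σ ρ s)

liftS-liftR : ∀ {k m n} (σ : Sub m n) (ρ : Ren k m) i → liftS σ (liftR ρ i) ≡ liftS (λ j → σ (ρ j)) i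
liftS-liftR σ ρ zero    = refl
liftS-liftR σ ρ (suc i) = refl

subF-renF : ∀ {k m n} (σ : Sub m n) (ρ : Ren k m) φ → subF σ (renF ρ φ) ≡ subF (λ i → σ (ρ i)) φ
subF-renF σ ρ (t ≐ s)  = cong₂ _≐_ (subT-renT σ ρ t) (subT-renT σ ρ s)
subF-renF σ ρ (t ≼ s)  = cong₂ _≼_ (subT-renT σ ρ t) (subT-renT σ ρ s)
subF-renF σ ρ ⊥'       = refl
subF-renF σ ρ (φ ⇒ ψ)  = cong₂ _⇒_ (subF-renF σ ρ φ) (subF-renF σ ρ ψ)
subF-renF σ ρ (φ ∧' ψ) = cong₂ _∧'_ (subF-renF σ ρ φ) (subF-renF σ ρ ψ)
subF-renF σ ρ (φ ∨' ψ) = cong₂ _∨'_ (subF-renF σ ρ φ) (subF-renF σ ρ ψ)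
subF-renF σ ρ (∀' φ)   = cong ∀' (trans (subF-renF (liftS σ) (liftR ρ) φ) (subF-cong (liftS-liftR σ ρ) φ))
subF-renF σ ρ (∃' φ)   = cong ∃' (trans (subF-renF (liftS σ) (liftR ρ) φ) (subF-cong (liftS-liftR σ ρ) φ))

renT-subT : ∀ {k m n} (ρ : Ren m n) (σ : Sub k m) t → renT ρ (subT σ t) ≡ subT (λ i → renT ρ (σ i)) t
renT-subT ρ σ (var i) = refl
renT-subT ρ σ 𝟎       = refl
renT-subT ρ σ (𝐒 t)   = cong 𝐒 (renT-subT ρ σ t)
renT-subT ρ σ (t ⊕ s) = cong₂ _⊕_ (renT-subT ρ σ t) (renT-subT ρ σ s)
renT-subT ρ σ (t ⊗ s) = cong₂ _⊗_ (renT-subT ρ σ t) (renT-subT ρ σ s)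

renT-liftS : ∀ {k m n} (ρ : Ren m n) (σ : Sub k m) i →
             renT (liftR ρ) (liftS σ i) ≡ liftS (λ j → renT ρ (σ j)) i
renT-liftS ρ σ zero    = refl
renT-liftS ρ σ (suc i) = trans (renT-renT (liftR ρ) suc (σ i)) (sym (renT-renT suc ρ (σ i)))

renF-subF : ∀ {k m n} (ρ : Ren m n) (σ : Sub k m) φ → renF ρ (subF σ φ) ≡ subF (λ i → renT ρ (σ i)) φ
renF-subF ρ σ (t ≐ s)  = cong₂ _≐_ (renT-subT ρ σ t) (renT-subT ρ σ s)
renF-subF ρ σ (t ≼ s)  = cong₂ _≼_ (renT-subT ρ σ t) (renT-subT ρ σ s)
renF-subF ρ σ ⊥'       = refl
renF-subF ρ σ (φ ⇒ ψ)  = cong₂ _⇒_ (renF-subF ρ σ φ) (renF-subF ρ σ ψ)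
renF-subF ρ σ (φ ∧' ψ) = cong₂ _∧'_ (renF-subF ρ σ φ) (renF-subF ρ σ ψ)
renF-subF ρ σ (φ ∨' ψ) = cong₂ _∨'_ (renF-subF ρ σ φ) (renF-subF ρ σ ψ)
renF-subF ρ σ (∀' φ)   = cong ∀' (trans (renF-subF (liftR ρ) (liftS σ) φ) (subF-cong (renT-liftS ρ σ) φ))
renF-subF ρ σ (∃' φ)   = cong ∃' (trans (renF-subF (liftR ρ) (liftS σ) φ) (subF-cong (renT-liftS ρ σ) φ))

subT-id : ∀ {m} {σ : Sub m m} → (∀ i → σ i ≡ var i) → ∀ t → subT σ t ≡ t
subT-id e (var i) = e i
subT-id e 𝟎       = refl
subT-id e (𝐒 t)   = cong 𝐒 (subT-id e t)
subT-id e (t ⊕ s) = cong₂ _⊕_ (subT-id e t) (subT-id e s)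
subT-id e (t ⊗ s) = cong₂ _⊗_ (subT-id e t) (subT-id e s)

liftS-id : ∀ {m} {σ : Sub m m} → (∀ i → σ i ≡ var i) → ∀ i → liftS σ i ≡ var i
liftS-id e zero    = refl
liftS-id e (suc i) = cong wkT (e i)

subF-id : ∀ {m} {σ : Sub m m} → (∀ i → σ i ≡ var i) → ∀ φ → subF σ φ ≡ φ
subF-id e (t ≐ s)  = cong₂ _≐_ (subT-id e t) (subT-id e s)
subF-id e (t ≼ s)  = cong₂ _≼_ (subT-id e t) (subT-id e s)
subF-id e ⊥'       = refl
subF-id e (φ ⇒ ψ)  = cong₂ _⇒_ (subF-id e φ) (subF-id e ψ)
subF-id e (φ ∧' ψ) = cong₂ _∧'_ (subF-id e φ) (subF-id e ψ)
subF-id e (φ ∨' ψ) = cong₂ _∨'_ (subF-id e φ) (subF-id e ψ)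
subF-id e (∀' φ)   = cong ∀' (subF-id (liftS-id e) φ)
subF-id e (∃' φ)   = cong ∃' (subF-id (liftS-id e) φ)

renT-as-subT : ∀ {m n} (ρ : Ren m n) t → renT ρ t ≡ subT (λ i → var (ρ i)) t
renT-as-subT ρ (var i) = refl
renT-as-subT ρ 𝟎       = refl
renT-as-subT ρ (𝐒 t)   = cong 𝐒 (renT-as-subT ρ t)
renT-as-subT ρ (t ⊕ s) = cong₂ _⊕_ (renT-as-subT ρ t) (renT-as-subT ρ s)
renT-as-subT ρ (t ⊗ s) = cong₂ _⊗_ (renT-as-subT ρ t) (renT-as-subT ρ s)

liftR-as-liftS : ∀ {m n} (ρ : Ren m n) i → var (liftR ρ i) ≡ liftS (λ j → var (ρ j)) i
liftR-as-liftS ρ zero    = refl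
liftR-as-liftS ρ (suc i) = refl

renF-as-subF : ∀ {m n} (ρ : Ren m n) φ → renF ρ φ ≡ subF (λ i → var (ρ i)) φ
renF-as-subF ρ (t ≐ s)  = cong₂ _≐_ (renT-as-subT ρ t) (renT-as-subT ρ s)
renF-as-subF ρ (t ≼ s)  = cong₂ _≼_ (renT-as-subT ρ t) (renT-as-subT ρ s)
renF-as-subF ρ ⊥'       = refl
renF-as-subF ρ (φ ⇒ ψ)  = cong₂ _⇒_ (renF-as-subF ρ φ) (renF-as-subF ρ ψ)
renF-as-subF ρ (φ ∧' ψ) = cong₂ _∧'_ (renF-as-subF ρ φ) (renF-as-subF ρ ψ)
renF-as-subF ρ (φ ∨' ψ) = cong₂ _∨'_ (renF-as-subF ρ φ) (renF-as-subF ρ ψ)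
renF-as-subF ρ (∀' φ)   = cong ∀' (trans (renF-as-subF (liftR ρ) φ) (subF-cong (liftR-as-liftS ρ) φ))
renF-as-subF ρ (∃' φ)   = cong ∃' (trans (renF-as-subF (liftR ρ) φ) (subF-cong (liftR-as-liftS ρ) φ))

subT-liftS-wkT : ∀ {m n} (σ : Sub m n) t → subT (liftS σ) (wkT t) ≡ wkT (subT σ t)
subT-liftS-wkT σ t = trans (subT-renT (liftS σ) suc t) (sym (renT-subT suc σ t))

subT-sub₀-wkT : ∀ {n} (u t : Tm n) → subT (sub₀ u) (wkT t) ≡ t
subT-sub₀-wkT u t = trans (subT-renT (sub₀ u) suc t) (subT-id (λ i → refl) t)

[]-as-sub₀ : ∀ {n} (φ : Fm (suc n)) t → φ [ t ] ≡ subF (sub₀ t) φ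
[]-as-sub₀ φ t = subF-cong (λ { zero → refl ; (suc i) → refl }) φ

renF-[] : ∀ {m n} (ρ : Ren m n) φ t → renF ρ (φ [ t ]) ≡ renF (liftR ρ) φ [ renT ρ t ]
renF-[] ρ φ t = begin
  renF ρ (φ [ t ])                                ≡⟨ cong (renF ρ) ([]-as-sub₀ φ t) ⟩
  renF ρ (subF (sub₀ t) φ)                        ≡⟨ renF-subF ρ (sub₀ t) φ ⟩
  subF (λ i → renT ρ (sub₀ t i)) φ                ≡⟨ subF-cong (λ { zero → refl ; (suc i) → refl }) φ ⟩
  subF (λ i → sub₀ (renT ρ t) (liftR ρ i)) φ      ≡⟨ subF-renF (sub₀ (renT ρ t)) (liftR ρ) φ ⟨
  subF (sub₀ (renT ρ t)) (renF (liftR ρ) φ)       ≡⟨ []-as-sub₀ (renF (liftR ρ) φ) (renT ρ t) ⟨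
  renF (liftR ρ) φ [ renT ρ t ]                   ∎
  where open ≡-Reasoning

renF-liftR-wkF : ∀ {m n} (ρ : Ren m n) φ → renF (liftR ρ) (wkF φ) ≡ wkF (renF ρ φ)
renF-liftR-wkF ρ φ = trans (renF-renF (liftR ρ) suc φ) (sym (renF-renF suc ρ φ))

renF-liftR-suc-[var0] : ∀ {n} (A : Fm (suc n)) → renF (liftR suc) A [ var zero ] ≡ A
renF-liftR-suc-[var0] A = trans ([]-as-sub₀ (renF (liftR suc) A) (var zero))
  (trans (subF-renF (sub₀ (var zero)) (liftR suc) A)
         (subF-id (λ { zero → refl ; (suc i) → refl }) A))

cast : ∀ {n} {Γ : List (Fm n)} {A B} → A ≡ B → Γ ⊢ A → Γ ⊢ B
cast {Γ = Γ} = subst (Γ ⊢_)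

hyp₀ : ∀ {n} {A : Fm n} {Γ} → (A ∷ Γ) ⊢ A
hyp₀ = hyp (here refl)

hyp₁ : ∀ {n} {A B : Fm n} {Γ} → (B ∷ A ∷ Γ) ⊢ A
hyp₁ = hyp (there (here refl))

hyp₂ : ∀ {n} {A B C : Fm n} {Γ} → (C ∷ B ∷ A ∷ Γ) ⊢ A
hyp₂ = hyp (there (there (here refl)))

⊢-weaken : ∀ {n} {Γ Δ : List (Fm n)} → Γ ⊆ Δ → ∀ {φ} → Γ ⊢ φ → Δ ⊢ φ
⊢-weaken Γ⊆Δ (hyp p)      = hyp (Γ⊆Δ p)
⊢-weaken Γ⊆Δ (⊥E d)       = ⊥E (⊢-weaken Γ⊆Δ d)
⊢-weaken Γ⊆Δ (raa d)      = raa (⊢-weaken (∷⁺ʳ _ Γ⊆Δ) d)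
⊢-weaken Γ⊆Δ (⇒I d)       = ⇒I (⊢-weaken (∷⁺ʳ _ Γ⊆Δ) d)
⊢-weaken Γ⊆Δ (⇒E d e)     = ⇒E (⊢-weaken Γ⊆Δ d) (⊢-weaken Γ⊆Δ e)
⊢-weaken Γ⊆Δ (∧I d e)     = ∧I (⊢-weaken Γ⊆Δ d) (⊢-weaken Γ⊆Δ e)
⊢-weaken Γ⊆Δ (∧E₁ d)      = ∧E₁ (⊢-weaken Γ⊆Δ d)
⊢-weaken Γ⊆Δ (∧E₂ d)      = ∧E₂ (⊢-weaken Γ⊆Δ d)
⊢-weaken Γ⊆Δ (∨I₁ d)      = ∨I₁ (⊢-weaken Γ⊆Δ d)
⊢-weaken Γ⊆Δ (∨I₂ d)      = ∨I₂ (⊢-weaken Γ⊆Δ d)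
⊢-weaken Γ⊆Δ (∨E d e f)   =
  ∨E (⊢-weaken Γ⊆Δ d) (⊢-weaken (∷⁺ʳ _ Γ⊆Δ) e) (⊢-weaken (∷⁺ʳ _ Γ⊆Δ) f)
⊢-weaken Γ⊆Δ (∀I d)       = ∀I (⊢-weaken (map⁺ wkF Γ⊆Δ) d)
⊢-weaken Γ⊆Δ (∀E d t)     = ∀E (⊢-weaken Γ⊆Δ d) t
⊢-weaken Γ⊆Δ (∃I t d)     = ∃I t (⊢-weaken Γ⊆Δ d)
⊢-weaken Γ⊆Δ (∃E d e)     = ∃E (⊢-weaken Γ⊆Δ d) (⊢-weaken (∷⁺ʳ _ (map⁺ wkF Γ⊆Δ)) e)
⊢-weaken Γ⊆Δ ≐refl        = ≐refl
⊢-weaken Γ⊆Δ (≐subst e d) = ≐subst (⊢-weaken Γ⊆Δ e) (⊢-weaken Γ⊆Δ d)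

map-renF-liftR-wkF : ∀ {m n} (ρ : Ren m n) (Γ : List (Fm m)) →
                     map (renF (liftR ρ)) (map wkF Γ) ≡ map wkF (map (renF ρ) Γ)
map-renF-liftR-wkF ρ Γ =
  trans (sym (map-∘ Γ)) (trans (map-cong (renF-liftR-wkF ρ) Γ) (map-∘ Γ))

liftR-⊆ : ∀ {m n} {Γ : List (Fm m)} {Δ : List (Fm n)} (ρ : Ren m n) →
          map (renF ρ) Γ ⊆ Δ → map (renF (liftR ρ)) (map wkF Γ) ⊆ map wkF Δ
liftR-⊆ {Γ = Γ} ρ Γ⊆Δ = ⊆-trans (⊆-reflexive (map-renF-liftR-wkF ρ Γ)) (map⁺ wkF Γ⊆Δ)

⊢-rename : ∀ {m n} {Γ : List (Fm m)} {Δ : List (Fm n)} (ρ : Ren m n) →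
           map (renF ρ) Γ ⊆ Δ → ∀ {φ} → Γ ⊢ φ → Δ ⊢ renF ρ φ
⊢-rename ρ Γ⊆Δ (hyp p)    = hyp (Γ⊆Δ (∈-map⁺ (renF ρ) p))
⊢-rename ρ Γ⊆Δ (⊥E d)     = ⊥E (⊢-rename ρ Γ⊆Δ d)
⊢-rename ρ Γ⊆Δ (raa d)    = raa (⊢-rename ρ (∷⁺ʳ _ Γ⊆Δ) d)
⊢-rename ρ Γ⊆Δ (⇒I d)     = ⇒I (⊢-rename ρ (∷⁺ʳ _ Γ⊆Δ) d)
⊢-rename ρ Γ⊆Δ (⇒E d e)   = ⇒E (⊢-rename ρ Γ⊆Δ d) (⊢-rename ρ Γ⊆Δ e)
⊢-rename ρ Γ⊆Δ (∧I d e)   = ∧I (⊢-rename ρ Γ⊆Δ d) (⊢-rename ρ Γ⊆Δ e)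
⊢-rename ρ Γ⊆Δ (∧E₁ d)    = ∧E₁ (⊢-rename ρ Γ⊆Δ d)
⊢-rename ρ Γ⊆Δ (∧E₂ d)    = ∧E₂ (⊢-rename ρ Γ⊆Δ d)
⊢-rename ρ Γ⊆Δ (∨I₁ d)    = ∨I₁ (⊢-rename ρ Γ⊆Δ d)
⊢-rename ρ Γ⊆Δ (∨I₂ d)    = ∨I₂ (⊢-rename ρ Γ⊆Δ d)
⊢-rename ρ Γ⊆Δ (∨E d e f) =
  ∨E (⊢-rename ρ Γ⊆Δ d) (⊢-rename ρ (∷⁺ʳ _ Γ⊆Δ) e) (⊢-rename ρ (∷⁺ʳ _ Γ⊆Δ) f)
⊢-rename ρ Γ⊆Δ (∀I d) = ∀I (⊢-rename (liftR ρ) (liftR-⊆ ρ Γ⊆Δ) d)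
⊢-rename ρ Γ⊆Δ (∀E {φ = φ} d t) = cast (sym (renF-[] ρ φ t)) (∀E (⊢-rename ρ Γ⊆Δ d) (renT ρ t))
⊢-rename ρ Γ⊆Δ (∃I {φ = φ} t d) = ∃I (renT ρ t) (cast (renF-[] ρ φ t) (⊢-rename ρ Γ⊆Δ d))
⊢-rename ρ Γ⊆Δ (∃E {ψ = ψ} d e) =
  ∃E (⊢-rename ρ Γ⊆Δ d) (cast (renF-liftR-wkF ρ ψ) (⊢-rename (liftR ρ) (∷⁺ʳ _ (liftR-⊆ ρ Γ⊆Δ)) e))
⊢-rename ρ Γ⊆Δ ≐refl = ≐refl
⊢-rename ρ Γ⊆Δ (≐subst {φ = φ} {s} {t} e d) =
  cast (sym (renF-[] ρ φ t)) (≐subst (⊢-rename ρ Γ⊆Δ e) (cast (renF-[] ρ φ s) (⊢-rename ρ Γ⊆Δ d)))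

module _ {n : ℕ} {Γ : List (Fm n)} where

  ⊢-wkF : ∀ {φ} → Γ ⊢ φ → map wkF Γ ⊢ wkF φ
  ⊢-wkF = ⊢-rename suc ⊆-refl

  ⊢-∷ : ∀ {ψ φ} → Γ ⊢ φ → (ψ ∷ Γ) ⊢ φ
  ⊢-∷ = ⊢-weaken (xs⊆x∷xs Γ _)

  ∀E-fresh : ∀ {A} → Γ ⊢ ∀' A → map wkF Γ ⊢ A
  ∀E-fresh {A} d = cast (renF-liftR-suc-[var0] A) (∀E (⊢-wkF d) (var zero))

  ∀E₀ : ∀ {A} → Γ ⊢ ∀' A → (t : Tm n) → Γ ⊢ subF (sub₀ t) A
  ∀E₀ {A} d t = cast ([]-as-sub₀ A t) (∀E d t)

  ∃I₀ : ∀ {A} (t : Tm n) → Γ ⊢ subF (sub₀ t) A → Γ ⊢ ∃' A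
  ∃I₀ {A} t d = ∃I t (cast (sym ([]-as-sub₀ A t)) d)

  -- A presents F as a formula with a hole, so that ≐subst applies.
  ≐-subst-by : ∀ (A : Fm (suc n)) (F : Tm n → Fm n) → (∀ x → subF (sub₀ x) A ≡ F x) →
               ∀ {s t} → Γ ⊢ s ≐ t → Γ ⊢ F s → Γ ⊢ F t
  ≐-subst-by A F A≡F {s} {t} e d =
    cast (trans ([]-as-sub₀ A t) (A≡F t)) (≐subst e (cast (sym (trans ([]-as-sub₀ A s) (A≡F s))) d))

  ≐sym : ∀ {s t} → Γ ⊢ s ≐ t → Γ ⊢ t ≐ s
  ≐sym {s} e = ≐-subst-by (var zero ≐ wkT s) (_≐ s) (λ x → cong (x ≐_) (subT-sub₀-wkT x s)) e ≐refl

  ≐trans : ∀ {r s t} → Γ ⊢ r ≐ s → Γ ⊢ s ≐ t → Γ ⊢ r ≐ t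
  ≐trans {r} e f = ≐-subst-by (wkT r ≐ var zero) (r ≐_) (λ x → cong (_≐ x) (subT-sub₀-wkT x r)) f e

  ≐-cong-𝐒 : ∀ {s t} → Γ ⊢ s ≐ t → Γ ⊢ 𝐒 s ≐ 𝐒 t
  ≐-cong-𝐒 {s} e = ≐-subst-by (𝐒 (wkT s) ≐ 𝐒 (var zero)) (λ x → 𝐒 s ≐ 𝐒 x)
    (λ x → cong (λ y → 𝐒 y ≐ 𝐒 x) (subT-sub₀-wkT x s)) e ≐refl

  ≐-cong-⊕ : ∀ {a b c d} → Γ ⊢ a ≐ b → Γ ⊢ c ≐ d → Γ ⊢ a ⊕ c ≐ b ⊕ d
  ≐-cong-⊕ {a} {b} {c} e f =
    ≐-subst-by (wkT (a ⊕ c) ≐ wkT b ⊕ var zero) (λ x → a ⊕ c ≐ b ⊕ x)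
      (λ x → cong₂ (λ p q → p ≐ q ⊕ x) (subT-sub₀-wkT x (a ⊕ c)) (subT-sub₀-wkT x b)) f
    (≐-subst-by (wkT (a ⊕ c) ≐ var zero ⊕ wkT c) (λ x → a ⊕ c ≐ x ⊕ c)
      (λ x → cong₂ (λ p q → p ≐ x ⊕ q) (subT-sub₀-wkT x (a ⊕ c)) (subT-sub₀-wkT x c)) e ≐refl)

  ≐-cong-⊗ : ∀ {a b c d} → Γ ⊢ a ≐ b → Γ ⊢ c ≐ d → Γ ⊢ a ⊗ c ≐ b ⊗ d
  ≐-cong-⊗ {a} {b} {c} e f =
    ≐-subst-by (wkT (a ⊗ c) ≐ wkT b ⊗ var zero) (λ x → a ⊗ c ≐ b ⊗ x)
      (λ x → cong₂ (λ p q → p ≐ q ⊗ x) (subT-sub₀-wkT x (a ⊗ c)) (subT-sub₀-wkT x b)) f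
    (≐-subst-by (wkT (a ⊗ c) ≐ var zero ⊗ wkT c) (λ x → a ⊗ c ≐ x ⊗ c)
      (λ x → cong₂ (λ p q → p ≐ x ⊗ q) (subT-sub₀-wkT x (a ⊗ c)) (subT-sub₀-wkT x c)) e ≐refl)

  ∃I-named : ∀ {A : Fm (suc n)} (u : Tm n) → ((var zero ≐ wkT u) ∷ map wkF Γ) ⊢ A → Γ ⊢ ∃' A
  ∃I-named {A} u d =
    ∃E (∃I₀ {A = var zero ≐ wkT u} u (cast (cong (u ≐_) (sym (subT-sub₀-wkT u u))) ≐refl))
       (∃I (var zero) (cast (sym (renF-liftR-suc-[var0] A)) d))

∃I-fresh : ∀ {n} {Δ : List (Fm (suc n))} {A : Fm (suc n)} → Δ ⊢ A → Δ ⊢ wkF (∃' A)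
∃I-fresh {A = A} d = ∃I (var zero) (cast (sym (renF-liftR-suc-[var0] A)) d)

⊩-axiom : ∀ {T : Theory} {φ} → T φ → T ⊩ φ
⊩-axiom a = _ , a ∷ [] , hyp₀

infix 0 ⊢_
⊢_ : Sentence → Set
⊢ φ = [] ⊢ φ

⊩-logical : ∀ {T : Theory} {φ} → ⊢ φ → T ⊩ φ
⊩-logical d = [] , [] , d

⊩-cast : ∀ {T : Theory} {A B} → A ≡ B → T ⊩ A → T ⊩ B
⊩-cast {T} = subst (T ⊩_)

⊩-map : ∀ {T : Theory} {A B} → (∀ {Γ : List Sentence} → Γ ⊢ A → Γ ⊢ B) → T ⊩ A → T ⊩ B
⊩-map f (Γ , a , d) = Γ , a , f d

⊩-zipWith : ∀ {T : Theory} {A B C} → (∀ {Γ : List Sentence} → Γ ⊢ A → Γ ⊢ B → Γ ⊢ C) →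
            T ⊩ A → T ⊩ B → T ⊩ C
⊩-zipWith f (Γ , a , d) (Δ , b , e) =
  Γ ++ Δ , ++⁺ a b , f (⊢-weaken (xs⊆xs++ys Γ Δ) d) (⊢-weaken (xs⊆ys++xs Δ Γ) e)

module ReadingOrderAs
  (_≼′_ : ∀ {m} → Tm m → Tm m → Fm m)
  (≼′-subF : ∀ {m n} (σ : Sub m n) t s → subF σ (t ≼′ s) ≡ subT σ t ≼′ subT σ s)
  where

  τ : Transl 1
  τ = record
    { δ  = 𝟎 ≐ 𝟎
    ; Eq = var zero ≐ var (suc zero)
    ; Le = var zero ≼′ var (suc zero)
    ; Zr = 𝟎 ≐ var zero
    ; Sc = 𝐒 (var zero) ≐ var (suc zero)
    ; Ad = var zero ⊕ var (suc zero) ≐ var (suc (suc zero))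
    ; Mu = var zero ⊗ var (suc zero) ≐ var (suc (suc zero))
    }

  open Translation τ

  reading : ∀ {n} → Fm n → Fm n
  reading (t ≐ s)  = t ≐ s
  reading (t ≼ s)  = t ≼′ s
  reading ⊥'       = ⊥'
  reading (φ ⇒ ψ)  = reading φ ⇒ reading ψ
  reading (φ ∧' ψ) = reading φ ∧' reading ψ
  reading (φ ∨' ψ) = reading φ ∨' reading ψ
  reading (∀' φ)   = ∀' (reading φ)
  reading (∃' φ)   = ∃' (reading φ)

  flatten : ∀ {n m} → (Fin n → Block m) → Sub n m
  flatten env i = var (env i zero)

  ≼′-renF : ∀ {m n} (ρ : Ren m n) t s → renF ρ (t ≼′ s) ≡ renT ρ t ≼′ renT ρ s
  ≼′-renF ρ t s = trans (renF-as-subF ρ (t ≼′ s)) (trans (≼′-subF _ t s)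
    (cong₂ _≼′_ (sym (renT-as-subT ρ t)) (sym (renT-as-subT ρ s))))

  ≼′-resp-≐ : ∀ {n} {Γ : List (Fm n)} {a a' b b'} →
              Γ ⊢ a ≐ a' → Γ ⊢ b ≐ b' → Γ ⊢ a ≼′ b → Γ ⊢ a' ≼′ b'
  ≼′-resp-≐ {a = a} {a'} {b} e f h =
    ≐-subst-by (wkT a' ≼′ var zero) (a' ≼′_)
      (λ x → trans (≼′-subF (sub₀ x) (wkT a') (var zero)) (cong (_≼′ x) (subT-sub₀-wkT x a'))) f
    (≐-subst-by (var zero ≼′ wkT b) (_≼′ b)
      (λ x → trans (≼′-subF (sub₀ x) (var zero) (wkT b)) (cong (x ≼′_) (subT-sub₀-wkT x b))) e h)

  flatten-wk : ∀ {n m} (env : Fin n → Block m) t →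
               subT (flatten (λ i → wk (env i))) t ≡ wkT (subT (flatten env) t)
  flatten-wk env t = sym (renT-subT suc (flatten env) t)

  flatten-wk² : ∀ {n m} (env : Fin n → Block m) t →
                subT (flatten (λ i → wk (wk (env i)))) t ≡ wkT (wkT (subT (flatten env) t))
  flatten-wk² env t = sym (trans (cong wkT (renT-subT suc (flatten env) t)) (renT-subT suc _ t))

  module BinaryShape {n m : ℕ} (t s : Tm n) (env : Fin n → Block m) (K : Fm (suc (suc m))) where

    env² : Fin n → Block (1 + (1 + m))
    env² i = wk (wk (env i))

    t′ s′ : Tm m
    t′ = subT (flatten env) t
    s′ = subT (flatten env) s

    Shape : Fm m
    Shape = ∃' ((𝟎 ≐ 𝟎) ∧' ∃' ((𝟎 ≐ 𝟎) ∧' Ev t env² (wk new) ∧' Ev s env² new ∧' K))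

    elim : ∀ {G : Fm m} {Γ : List (Fm m)} →
      (∀ {Δ} → Δ ⊢ Ev t env² (wk new) → Δ ⊢ subT (flatten env²) t ≐ var (suc zero)) →
      (∀ {Δ} → Δ ⊢ Ev s env² new → Δ ⊢ subT (flatten env²) s ≐ var zero) →
      (∀ {Δ} → Δ ⊢ wkT (wkT t′) ≐ var (suc zero) → Δ ⊢ wkT (wkT s′) ≐ var zero → Δ ⊢ K →
               Δ ⊢ wkF (wkF G)) →
      Γ ⊢ Shape → Γ ⊢ G
    elim evalT evalS conclude d = ∃E d (∃E (∧E₂ hyp₀)
      (conclude (cast (cong (_≐ var (suc zero)) (flatten-wk² env t)) (evalT (∧E₁ (∧E₂ hyp₀))))
                (cast (cong (_≐ var zero) (flatten-wk² env s)) (evalS (∧E₁ (∧E₂ (∧E₂ hyp₀)))))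
                (∧E₂ (∧E₂ (∧E₂ hyp₀)))))

    intro : ∀ {G : Fm m} {Γ : List (Fm m)} →
      (∀ {Δ} → Δ ⊢ subT (flatten env²) t ≐ var (suc zero) → Δ ⊢ Ev t env² (wk new)) →
      (∀ {Δ} → Δ ⊢ subT (flatten env²) s ≐ var zero → Δ ⊢ Ev s env² new) →
      (∀ {Δ} → Δ ⊢ wkF (wkF G) → Δ ⊢ var (suc zero) ≐ wkT (wkT t′) → Δ ⊢ var zero ≐ wkT (wkT s′) →
               Δ ⊢ K) →
      Γ ⊢ G → Γ ⊢ Shape
    intro evalT evalS establish d = ∃I-named t′ (∧I ≐refl (∃I-named (wkT s′) (∧I ≐refl
      (∧I (evalT (cast (cong (_≐ var (suc zero)) (sym (flatten-wk² env t))) (≐sym hyp₁)))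
      (∧I (evalS (cast (cong (_≐ var zero) (sym (flatten-wk² env s))) (≐sym hyp₀)))
          (establish (⊢-∷ (⊢-wkF (⊢-∷ (⊢-wkF d)))) hyp₁ hyp₀))))))

  Ev⇒≐ : ∀ {n m} (t : Tm n) (env : Fin n → Block m) (o : Block m) {Γ : List (Fm m)} →
         Γ ⊢ Ev t env o → Γ ⊢ subT (flatten env) t ≐ var (o zero)
  ≐⇒Ev : ∀ {n m} (t : Tm n) (env : Fin n → Block m) (o : Block m) {Γ : List (Fm m)} →
         Γ ⊢ subT (flatten env) t ≐ var (o zero) → Γ ⊢ Ev t env o

  Ev⇒≐ (var i) env o d = d
  Ev⇒≐ 𝟎       env o d = d
  Ev⇒≐ (𝐒 t)   env o d = ∃E d (≐trans
    (≐-cong-𝐒 (cast (cong (_≐ var zero) (flatten-wk env t))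
                    (Ev⇒≐ t (λ i → wk (env i)) new (∧E₁ (∧E₂ hyp₀)))))
    (∧E₂ (∧E₂ hyp₀)))
  Ev⇒≐ (t ⊕ s) env o d = BinaryShape.elim t s env _ (Ev⇒≐ t _ _) (Ev⇒≐ s _ _)
    (λ t≐x s≐y x+y≐o → ≐trans (≐-cong-⊕ t≐x s≐y) x+y≐o) d
  Ev⇒≐ (t ⊗ s) env o d = BinaryShape.elim t s env _ (Ev⇒≐ t _ _) (Ev⇒≐ s _ _)
    (λ t≐x s≐y x*y≐o → ≐trans (≐-cong-⊗ t≐x s≐y) x*y≐o) d

  ≐⇒Ev (var i) env o d = d
  ≐⇒Ev 𝟎       env o d = d
  ≐⇒Ev (𝐒 t)   env o d = ∃I-named (subT (flatten env) t) (∧I ≐refl (∧I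
    (≐⇒Ev t (λ i → wk (env i)) new (cast (cong (_≐ var zero) (sym (flatten-wk env t))) (≐sym hyp₀)))
    (≐trans (≐-cong-𝐒 hyp₀) (⊢-∷ (⊢-wkF d)))))
  ≐⇒Ev (t ⊕ s) env o d = BinaryShape.intro t s env _ (≐⇒Ev t _ _) (≐⇒Ev s _ _)
    (λ t+s≐o x≐t y≐s → ≐trans (≐-cong-⊕ x≐t y≐s) t+s≐o) d
  ≐⇒Ev (t ⊗ s) env o d = BinaryShape.intro t s env _ (≐⇒Ev t _ _) (≐⇒Ev s _ _)
    (λ t*s≐o x≐t y≐s → ≐trans (≐-cong-⊗ x≐t y≐s) t*s≐o) d

  flatten-ext : ∀ {n m} (env : Fin n → Block m) (φ : Fm (suc n)) →
                subF (flatten (ext env)) φ ≡ subF (liftS (flatten env)) φ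
  flatten-ext env φ = subF-cong (λ { zero → refl ; (suc i) → refl }) φ

  Le-new : ∀ {m} → inst2 {m = suc (suc m)} (var zero ≼′ var (suc zero)) (wk new) new
                   ≡ var (suc zero) ≼′ var zero
  Le-new = ≼′-renF _ (var zero) (var (suc zero))

  ≼′-wkF² : ∀ {m} (a b : Tm m) → wkF (wkF (a ≼′ b)) ≡ wkT (wkT a) ≼′ wkT (wkT b)
  ≼′-wkF² a b = trans (cong wkF (≼′-renF suc a b)) (≼′-renF suc (wkT a) (wkT b))

  tr⇒reading : ∀ {n m} (φ : Fm n) (env : Fin n → Block m) {Γ : List (Fm m)} →
               Γ ⊢ tr φ env → Γ ⊢ subF (flatten env) (reading φ)
  reading⇒tr : ∀ {n m} (φ : Fm n) (env : Fin n → Block m) {Γ : List (Fm m)} →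
               Γ ⊢ subF (flatten env) (reading φ) → Γ ⊢ tr φ env

  tr⇒reading (t ≐ s) env d = BinaryShape.elim t s env _ (Ev⇒≐ t _ _) (Ev⇒≐ s _ _)
    (λ t≐x s≐y x≐y → ≐trans t≐x (≐trans x≐y (≐sym s≐y))) d
  tr⇒reading (t ≼ s) env d = cast (sym (≼′-subF (flatten env) t s))
    (BinaryShape.elim t s env _ (Ev⇒≐ t _ _) (Ev⇒≐ s _ _)
      (λ t≐x s≐y x≼y →
         cast (sym (≼′-wkF² _ _)) (≼′-resp-≐ (≐sym t≐x) (≐sym s≐y) (cast Le-new x≼y))) d)
  tr⇒reading ⊥'       env d = d
  tr⇒reading (φ ⇒ ψ)  env d = ⇒I (tr⇒reading ψ env (⇒E (⊢-∷ d) (reading⇒tr φ env hyp₀)))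
  tr⇒reading (φ ∧' ψ) env d = ∧I (tr⇒reading φ env (∧E₁ d)) (tr⇒reading ψ env (∧E₂ d))
  tr⇒reading (φ ∨' ψ) env d = ∨E d (∨I₁ (tr⇒reading φ env hyp₀)) (∨I₂ (tr⇒reading ψ env hyp₀))
  tr⇒reading (∀' φ)   env d =
    ∀I (cast (flatten-ext env (reading φ)) (tr⇒reading φ (ext env) (⇒E (∀E-fresh d) ≐refl)))
  tr⇒reading (∃' φ)   env d =
    ∃E d (∃I-fresh (cast (flatten-ext env (reading φ)) (tr⇒reading φ (ext env) (∧E₂ hyp₀))))

  reading⇒tr (t ≐ s) env d = BinaryShape.intro t s env _ (≐⇒Ev t _ _) (≐⇒Ev s _ _)
    (λ t≐s x≐t y≐s → ≐trans x≐t (≐trans t≐s (≐sym y≐s))) d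
  reading⇒tr (t ≼ s) env d = BinaryShape.intro t s env _ (≐⇒Ev t _ _) (≐⇒Ev s _ _)
    (λ t≼s x≐t y≐s →
       cast (sym Le-new) (≼′-resp-≐ (≐sym x≐t) (≐sym y≐s) (cast (≼′-wkF² _ _) t≼s)))
    (cast (≼′-subF (flatten env) t s) d)
  reading⇒tr ⊥'       env d = d
  reading⇒tr (φ ⇒ ψ)  env d = ⇒I (reading⇒tr ψ env (⇒E (⊢-∷ d) (tr⇒reading φ env hyp₀)))
  reading⇒tr (φ ∧' ψ) env d = ∧I (reading⇒tr φ env (∧E₁ d)) (reading⇒tr ψ env (∧E₂ d))
  reading⇒tr (φ ∨' ψ) env d = ∨E d (∨I₁ (reading⇒tr φ env hyp₀)) (∨I₂ (reading⇒tr ψ env hyp₀))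
  reading⇒tr (∀' φ)   env d =
    ∀I (⇒I (⊢-∷ (reading⇒tr φ (ext env) (cast (sym (flatten-ext env (reading φ))) (∀E-fresh d)))))
  reading⇒tr (∃' φ)   env d =
    ∃E d (∃I-fresh (∧I ≐refl (reading⇒tr φ (ext env) (cast (sym (flatten-ext env (reading φ))) hyp₀))))

  ⊩-tr : ∀ {T : Theory} (φ : Sentence) → T ⊩ reading φ → T ⊩ trS φ
  ⊩-tr φ = ⊩-map (λ d → reading⇒tr φ (λ ()) (cast (sym (subF-id (λ ()) (reading φ))) d))

  isInterpretation : ∀ {S T : Theory} → (∀ φ → S φ → T ⊩ reading φ) → IsInterpretation S T τ
  isInterpretation {S} {T} S⇒reading = record
    { dom      = ⊩-logical (∃I₀ 𝟎 ≐refl)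
    ; zeroTot  = ⊩-logical (∃I₀ 𝟎 (∧I ≐refl ≐refl))
    ; zeroUni  = ⊩-logical (∀I (∀I (⇒I (functional (∧E₂ (∧E₂ hyp₀))))))
    ; sucTot   = ⊩-logical (∀I (⇒I (∃I₀ (𝐒 (var zero)) (∧I ≐refl ≐refl))))
    ; sucUni   = ⊩-logical (∀I (∀I (∀I (⇒I (functional (∧E₂ (∧E₂ (∧E₂ hyp₀))))))))
    ; addTot   = ⊩-logical (∀I (∀I (⇒I (∃I₀ (var (suc zero) ⊕ var zero) (∧I ≐refl ≐refl)))))
    ; addUni   = ⊩-logical (∀I (∀I (∀I (∀I (⇒I (functional (∧E₂ (∧E₂ (∧E₂ (∧E₂ hyp₀))))))))))
    ; mulTot   = ⊩-logical (∀I (∀I (⇒I (∃I₀ (var (suc zero) ⊗ var zero) (∧I ≐refl ≐refl)))))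
    ; mulUni   = ⊩-logical (∀I (∀I (∀I (∀I (⇒I (functional (∧E₂ (∧E₂ (∧E₂ (∧E₂ hyp₀))))))))))
    ; eqAxioms = equality
    ; axioms   = λ φ a → ⊩-tr φ (S⇒reading φ a)
    }
    where
    functional : ∀ {n} {Γ : List (Fm n)} {t a b} → Γ ⊢ (t ≐ a) ∧' (t ≐ b) → Γ ⊢ a ≐ b
    functional d = ≐trans (≐sym (∧E₁ d)) (∧E₂ d)

    equality : ∀ φ → EqAx φ → T ⊩ trS φ
    equality φ e-refl = ⊩-tr φ (⊩-logical (∀I ≐refl))
    equality φ e-≐ =
      ⊩-tr φ (⊩-logical (∀I (∀I (∀I (∀I (⇒I (⇒I (⇒I (≐trans (≐sym hyp₂) (≐trans hyp₀ hyp₁))))))))))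
    equality φ e-≼ =
      ⊩-tr φ (⊩-logical (∀I (∀I (∀I (∀I (⇒I (⇒I (⇒I (≼′-resp-≐ hyp₂ hyp₁ hyp₀)))))))))
    equality φ e-S = ⊩-tr φ (⊩-logical (∀I (∀I (⇒I (≐-cong-𝐒 hyp₀)))))
    equality φ e-+ = ⊩-tr φ (⊩-logical (∀I (∀I (∀I (∀I (⇒I (⇒I (≐-cong-⊕ hyp₁ hyp₀))))))))
    equality φ e-* = ⊩-tr φ (⊩-logical (∀I (∀I (∀I (∀I (⇒I (⇒I (≐-cong-⊗ hyp₁ hyp₀))))))))

module Identity = ReadingOrderAs _≼_ (λ σ t s → refl)

reading-≼-id : ∀ {n} (φ : Fm n) → Identity.reading φ ≡ φ
reading-≼-id (t ≐ s)  = refl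
reading-≼-id (t ≼ s)  = refl
reading-≼-id ⊥'       = refl
reading-≼-id (φ ⇒ ψ)  = cong₂ _⇒_ (reading-≼-id φ) (reading-≼-id ψ)
reading-≼-id (φ ∧' ψ) = cong₂ _∧'_ (reading-≼-id φ) (reading-≼-id ψ)
reading-≼-id (φ ∨' ψ) = cong₂ _∨'_ (reading-≼-id φ) (reading-≼-id ψ)
reading-≼-id (∀' φ)   = cong ∀' (reading-≼-id φ)
reading-≼-id (∃' φ)   = cong ∃' (reading-≼-id φ)

IQ⁺-interpretable-in-IQ⁺⁺ : Interpretable IQ⁺ IQ⁺⁺
IQ⁺-interpretable-in-IQ⁺⁺ = 0 , Identity.τ ,
  Identity.isInterpretation (λ φ a → ⊩-cast (sym (reading-≼-id φ)) (⊩-axiom (base a)))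

v0 : ∀ {n} → Tm (suc n)
v0 = var zero

v1 : ∀ {n} → Tm (suc (suc n))
v1 = var (suc zero)

-- The clauses are what the two extra axioms of IQ⁺⁺ need at z (0 ≤ z and
-- x ≤ z → Sx ≤ Sz), plus what is needed to pass hereditary tameness from Sz to z.
Tame : ∀ {m} → Tm m → Fm m
Tame z = (z ≼ z) ∧' (𝟎 ≼ z) ∧' ∀' (v0 ≼ wkT z ⇒ v0 ≼ 𝐒 (wkT z))
       ∧' ∀' (v0 ≼ wkT z ⇒ 𝐒 v0 ≼ 𝐒 (wkT z)) ∧' ∀' (𝐒 v0 ≐ wkT z ⇒ v0 ≼ wkT z)

HerTame : ∀ {m} → Tm m → Fm m
HerTame y = (y ≼ y) ∧' ∀' (v0 ≼ wkT y ⇒ Tame v0)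

infix 5 _≼ₕ_
_≼ₕ_ : ∀ {m} → Tm m → Tm m → Fm m
t ≼ₕ s = HerTame s ⇒ t ≼ s

Tame-subF : ∀ {m n} (σ : Sub m n) z → subF σ (Tame z) ≡ Tame (subT σ z)
Tame-subF σ z rewrite subT-liftS-wkT σ z = refl

tame-≐ : ∀ {m} {Γ : List (Fm m)} {s t} → Γ ⊢ s ≐ t → Γ ⊢ Tame s → Γ ⊢ Tame t
tame-≐ = ≐-subst-by (Tame v0) Tame (λ x → Tame-subF (sub₀ x) v0)

HerTame-subF : ∀ {m n} (σ : Sub m n) y → subF σ (HerTame y) ≡ HerTame (subT σ y)
HerTame-subF σ y rewrite subT-liftS-wkT σ y | Tame-subF (liftS σ) (var zero) = refl

≼ₕ-subF : ∀ {m n} (σ : Sub m n) t s → subF σ (t ≼ₕ s) ≡ subT σ t ≼ₕ subT σ s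
≼ₕ-subF σ t s rewrite HerTame-subF σ s = refl

Tame-renF : ∀ {m n} (ρ : Ren m n) z → renF ρ (Tame z) ≡ Tame (renT ρ z)
Tame-renF ρ z = trans (renF-as-subF ρ (Tame z)) (trans (Tame-subF _ z) (cong Tame (sym (renT-as-subT ρ z))))

HerTame-renF : ∀ {m n} (ρ : Ren m n) z → renF ρ (HerTame z) ≡ HerTame (renT ρ z)
HerTame-renF ρ z = trans (renF-as-subF ρ (HerTame z)) (trans (HerTame-subF _ z) (cong HerTame (sym (renT-as-subT ρ z))))

module _ {m : ℕ} {Γ : List (Fm m)} where

  herTame-below : ∀ {y a} → Γ ⊢ HerTame y → Γ ⊢ a ≼ y → Γ ⊢ Tame a
  herTame-below {y} {a} d = ⇒E
    (cast (cong₂ (λ p q → (a ≼ p) ⇒ q) (subT-sub₀-wkT a y) (Tame-subF (sub₀ a) (var zero)))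
          (∀E₀ (∧E₂ d) a))

  herTame-tame : ∀ {y} → Γ ⊢ HerTame y → Γ ⊢ Tame y
  herTame-tame d = herTame-below d (∧E₁ d)

  tame-refl : ∀ {z} → Γ ⊢ Tame z → Γ ⊢ z ≼ z
  tame-refl = ∧E₁

  tame-0≼ : ∀ {z} → Γ ⊢ Tame z → Γ ⊢ 𝟎 ≼ z
  tame-0≼ d = ∧E₁ (∧E₂ d)

  tame-≼𝐒 : ∀ {z x} → Γ ⊢ Tame z → Γ ⊢ x ≼ z → Γ ⊢ x ≼ 𝐒 z
  tame-≼𝐒 {z} {x} d = ⇒E
    (cast (cong (λ p → (x ≼ p) ⇒ (x ≼ 𝐒 p)) (subT-sub₀-wkT x z)) (∀E₀ (∧E₁ (∧E₂ (∧E₂ d))) x))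

  tame-𝐒≼𝐒 : ∀ {z x} → Γ ⊢ Tame z → Γ ⊢ x ≼ z → Γ ⊢ 𝐒 x ≼ 𝐒 z
  tame-𝐒≼𝐒 {z} {x} d = ⇒E
    (cast (cong (λ p → (x ≼ p) ⇒ (𝐒 x ≼ 𝐒 p)) (subT-sub₀-wkT x z))
          (∀E₀ (∧E₁ (∧E₂ (∧E₂ (∧E₂ d)))) x))

  tame-pred≼ : ∀ {z x} → Γ ⊢ Tame z → Γ ⊢ 𝐒 x ≐ z → Γ ⊢ x ≼ z
  tame-pred≼ {z} {x} d = ⇒E
    (cast (cong (λ p → (𝐒 x ≐ p) ⇒ (x ≼ p)) (subT-sub₀-wkT x z))
          (∀E₀ (∧E₂ (∧E₂ (∧E₂ (∧E₂ d)))) x))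

0≼ₕ : ⊢ ∀' (𝟎 ≼ₕ v0)
0≼ₕ = ∀I (⇒I (tame-0≼ (herTame-tame hyp₀)))

≼ₕ-mono : ⊢ ∀' (∀' (v1 ≼ₕ v0 ⇒ 𝐒 v1 ≼ₕ 𝐒 v0))
≼ₕ-mono = ∀I (∀I (⇒I (⇒I (tame-𝐒≼𝐒 tame-y (⇒E hyp₁ herTame-y)))))
  where
  Δ : List (Fm 2)
  Δ = HerTame (𝐒 v0) ∷ (v1 ≼ₕ v0) ∷ []

  tame-y : Δ ⊢ Tame v0
  tame-y = herTame-below hyp₀ (tame-pred≼ (herTame-tame hyp₀) ≐refl)

  herTame-y : Δ ⊢ HerTame v0
  herTame-y = ∧I (tame-refl tame-y)
    (∀I (⇒I (herTame-below {y = 𝐒 v1} (⊢-∷ (⊢-wkF hyp₀)) (tame-≼𝐒 (⊢-∷ (⊢-wkF tame-y)) hyp₀))))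

subT-num : ∀ {m n} (σ : Sub m n) k → subT σ (num k) ≡ num k
subT-num σ zero    = refl
subT-num σ (suc k) = cong 𝐒 (subT-num σ k)

renT-num : ∀ {m n} (ρ : Ren m n) k → renT ρ (num k) ≡ num k
renT-num ρ k = trans (renT-as-subT ρ (num k)) (subT-num _ k)

subF-bigOr : ∀ {m n} (σ : Sub m n) t k → subF σ (bigOr t k) ≡ bigOr (subT σ t) k
subF-bigOr σ t zero    = refl
subF-bigOr σ t (suc k) = cong₂ _∨'_ (subF-bigOr σ t k) (cong (subT σ t ≐_) (subT-num σ (suc k)))

renF-bigOr : ∀ {m n} (ρ : Ren m n) t k → renF ρ (bigOr t k) ≡ bigOr (renT ρ t) k
renF-bigOr ρ t k =
  trans (renF-as-subF ρ (bigOr t k)) (trans (subF-bigOr _ t k) (cong (λ x → bigOr x k) (sym (renT-as-subT ρ t))))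

OrderSchema : ∀ {m} → ℕ → Fm m
OrderSchema k = ∀' ((v0 ≼ num k) ⇔ bigOr v0 k)

OrderSchema-inst : ∀ {m} (t : Tm m) k →
                   subF (sub₀ t) ((v0 ≼ num k) ⇔ bigOr v0 k) ≡ ((t ≼ num k) ⇔ bigOr t k)
OrderSchema-inst t k rewrite subT-num (sub₀ t) k | subF-bigOr (sub₀ t) (var zero) k = refl

OrderSchema-renF : ∀ {m n} (ρ : Ren m n) k → renF ρ (OrderSchema k) ≡ OrderSchema k
OrderSchema-renF ρ k rewrite renT-num (liftR ρ) k | renF-bigOr (liftR ρ) (var zero) k = refl

module _ {m : ℕ} {Γ : List (Fm m)} where

  schema⇒ : ∀ {k t} → Γ ⊢ OrderSchema k → Γ ⊢ t ≼ num k → Γ ⊢ bigOr t k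
  schema⇒ {k} {t} d = ⇒E (∧E₁ (cast (OrderSchema-inst t k) (∀E₀ d t)))

  schema⇐ : ∀ {k t} → Γ ⊢ OrderSchema k → Γ ⊢ bigOr t k → Γ ⊢ t ≼ num k
  schema⇐ {k} {t} d = ⇒E (∧E₂ (cast (OrderSchema-inst t k) (∀E₀ d t)))

  bigOr-last : ∀ {k t} → Γ ⊢ t ≐ num k → Γ ⊢ bigOr t k
  bigOr-last {zero}  e = e
  bigOr-last {suc k} e = ∨I₂ e

  bigOr-𝟎 : ∀ k → Γ ⊢ bigOr 𝟎 k
  bigOr-𝟎 zero    = ≐refl
  bigOr-𝟎 (suc k) = ∨I₁ (bigOr-𝟎 k)

bigOr-𝐒 : ∀ {m} {Γ : List (Fm m)} k {t} → Γ ⊢ bigOr t k → Γ ⊢ bigOr (𝐒 t) (suc k)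
bigOr-𝐒 zero    d = ∨I₂ (≐-cong-𝐒 d)
bigOr-𝐒 (suc k) d = ∨E d (∨I₁ (bigOr-𝐒 k hyp₀)) (∨I₂ (≐-cong-𝐒 hyp₀))

SuccInjective SuccNonzero : ∀ {m} → Fm m
SuccInjective = ∀' (∀' (¬' (v1 ≐ v0) ⇒ ¬' (𝐒 v1 ≐ 𝐒 v0)))
SuccNonzero   = ∀' (¬' (𝐒 v0 ≐ 𝟎))

record NumeralAxioms {m : ℕ} (Γ : List (Fm m)) (k : ℕ) : Set where
  field
    succ-injective : Γ ⊢ SuccInjective
    succ-nonzero   : Γ ⊢ SuccNonzero
    schema         : Γ ⊢ OrderSchema k
    schema-suc     : Γ ⊢ OrderSchema (suc k)
open NumeralAxioms

NumeralAxioms-wkF : ∀ {m} {Γ : List (Fm m)} {k} → NumeralAxioms Γ k → NumeralAxioms (map wkF Γ) k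
NumeralAxioms-wkF {k = k} A = record
  { succ-injective = ⊢-wkF (succ-injective A)
  ; succ-nonzero   = ⊢-wkF (succ-nonzero A)
  ; schema         = cast (OrderSchema-renF suc k) (⊢-wkF (schema A))
  ; schema-suc     = cast (OrderSchema-renF suc (suc k)) (⊢-wkF (schema-suc A))
  }

NumeralAxioms-∷ : ∀ {m} {Γ : List (Fm m)} {ψ k} → NumeralAxioms Γ k → NumeralAxioms (ψ ∷ Γ) k
NumeralAxioms-∷ A = record
  { succ-injective = ⊢-∷ (succ-injective A)
  ; succ-nonzero   = ⊢-∷ (succ-nonzero A)
  ; schema         = ⊢-∷ (schema A)
  ; schema-suc     = ⊢-∷ (schema-suc A)
  }

pred-≼-num : ∀ {m} {Γ : List (Fm (suc m))} j →
             NumeralAxioms ((𝐒 v0 ≐ num j) ∷ Γ) j → ((𝐒 v0 ≐ num j) ∷ Γ) ⊢ v0 ≼ num j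
pred-≼-num zero A = ⊥E (⇒E (∀E₀ (succ-nonzero A) v0) hyp₀)
pred-≼-num (suc j) A = schema⇐ (schema A) (∨I₁ (bigOr-last
  (raa (⇒E (⇒E (∀E₀ (∀E₀ (⊢-∷ (succ-injective A)) v0) (num j)) hyp₀) hyp₁))))

numeral-tame : ∀ {m} {Γ : List (Fm m)} k → NumeralAxioms Γ k → Γ ⊢ Tame (num k)
numeral-tame {Γ = Γ} k A =
  ∧I (schema⇐ (schema A) (bigOr-last ≐refl))
  (∧I (schema⇐ (schema A) (bigOr-𝟎 k))
  (∧I (∀I (cast (cong (λ p → (v0 ≼ p) ⇒ (v0 ≼ 𝐒 p)) (sym (renT-num suc k)))
        (⇒I (schema⇐ (schema-suc A′) (∨I₁ (schema⇒ (schema A′) hyp₀))))))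
  (∧I (∀I (cast (cong (λ p → (v0 ≼ p) ⇒ (𝐒 v0 ≼ 𝐒 p)) (sym (renT-num suc k)))
        (⇒I (schema⇐ (schema-suc A′) (bigOr-𝐒 k (schema⇒ (schema A′) hyp₀))))))
      (∀I (cast (cong (λ p → (𝐒 v0 ≐ p) ⇒ (v0 ≼ p)) (sym (renT-num suc k)))
        (⇒I (pred-≼-num k A′)))))))
  where
  A′ : ∀ {ψ} → NumeralAxioms (ψ ∷ map wkF Γ) k
  A′ = NumeralAxioms-∷ (NumeralAxioms-wkF A)

TameUpTo : ∀ {m} → ℕ → Fm m
TameUpTo n = ∀' (bigOr v0 n ⇒ Tame v0)

module _ {m : ℕ} {Γ : List (Fm m)} where

  tame-num-wk : ∀ {ψ} k → Γ ⊢ Tame (num k) → (ψ ∷ map wkF Γ) ⊢ Tame (num k)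
  tame-num-wk k d = ⊢-∷ (cast (trans (Tame-renF suc (num k)) (cong Tame (renT-num suc k))) (⊢-wkF d))

  tameUpTo-zero : Γ ⊢ Tame (num 0) → Γ ⊢ TameUpTo 0
  tameUpTo-zero d = ∀I (⇒I (tame-≐ (≐sym hyp₀) (tame-num-wk 0 d)))

  tameUpTo-suc : ∀ n → Γ ⊢ TameUpTo n → Γ ⊢ Tame (num (suc n)) → Γ ⊢ TameUpTo (suc n)
  tameUpTo-suc n below d = ∀I (⇒I (∨E hyp₀
    (⇒E (⊢-∷ (⊢-∷ (∀E-fresh below))) hyp₀)
    (tame-≐ (≐sym hyp₀) (⊢-∷ (tame-num-wk (suc n) d)))))

  numeral-herTame : ∀ n → Γ ⊢ OrderSchema n → Γ ⊢ TameUpTo n → Γ ⊢ HerTame (num n)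
  numeral-herTame n schema-n below = ∧I (schema⇐ schema-n (bigOr-last ≐refl))
    (∀I (cast (cong (λ p → (v0 ≼ p) ⇒ Tame v0) (sym (renT-num suc n)))
      (⇒I (⇒E (⊢-∷ (∀E-fresh below))
              (schema⇒ (⊢-∷ (cast (OrderSchema-renF suc n) (⊢-wkF schema-n))) hyp₀)))))

  ≼ₕ-schema : ∀ n → Γ ⊢ OrderSchema n → Γ ⊢ HerTame (num n) →
              Γ ⊢ ∀' ((v0 ≼ₕ num n ⇒ bigOr v0 n) ∧' (bigOr v0 n ⇒ v0 ≼ₕ num n))
  ≼ₕ-schema n schema-n herTame-n =
    ∀I (∧I (⇒I (schema⇒ (⊢-∷ schema-n′) (⇒E hyp₀ herTame-n′)))
           (⇒I (⇒I (schema⇐ (⊢-∷ (⊢-∷ schema-n′)) hyp₁))))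
    where
    schema-n′ : map wkF Γ ⊢ OrderSchema n
    schema-n′ = cast (OrderSchema-renF suc n) (⊢-wkF schema-n)
    herTame-n′ : ∀ {ψ} → (ψ ∷ map wkF Γ) ⊢ HerTame (num n)
    herTame-n′ = ⊢-∷ (cast (trans (HerTame-renF suc (num n)) (cong HerTame (renT-num suc n))) (⊢-wkF herTame-n))

module Hereditary = ReadingOrderAs _≼ₕ_ ≼ₕ-subF

IQ⁺⊩numeral-tame : ∀ k → IQ⁺ ⊩ Tame (num k)
IQ⁺⊩numeral-tame k =
  _ , base iq1 ∷ base iq2 ∷ base (iq≤ k) ∷ base (iq≤ (suc k)) ∷ [] ,
  numeral-tame k (record
    { succ-injective = hyp₀
    ; succ-nonzero   = hyp₁
    ; schema         = hyp₂
    ; schema-suc     = hyp (there (there (there (here refl))))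
    })

IQ⁺⊩tameUpTo : ∀ n → IQ⁺ ⊩ TameUpTo n
IQ⁺⊩tameUpTo zero    = ⊩-map tameUpTo-zero (IQ⁺⊩numeral-tame 0)
IQ⁺⊩tameUpTo (suc n) = ⊩-zipWith (tameUpTo-suc n) (IQ⁺⊩tameUpTo n) (IQ⁺⊩numeral-tame (suc n))

IQ⁺⊩numeral-herTame : ∀ n → IQ⁺ ⊩ HerTame (num n)
IQ⁺⊩numeral-herTame n = ⊩-zipWith (numeral-herTame n) (⊩-axiom (base (iq≤ n))) (IQ⁺⊩tameUpTo n)

reading-bigOr : ∀ {m} (t : Tm m) k → Hereditary.reading (bigOr t k) ≡ bigOr t k
reading-bigOr t zero    = refl
reading-bigOr t (suc k) = cong (_∨' (t ≐ num (suc k))) (reading-bigOr t k)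

IQ⁺⊩reading-iq≤ : ∀ n → IQ⁺ ⊩ Hereditary.reading (∀' ((v0 ≼ num n) ⇔ bigOr v0 n))
IQ⁺⊩reading-iq≤ n =
  ⊩-cast (cong (λ B → ∀' ((v0 ≼ₕ num n ⇒ B) ∧' (B ⇒ v0 ≼ₕ num n))) (sym (reading-bigOr v0 n)))
    (⊩-zipWith (≼ₕ-schema n) (⊩-axiom (base (iq≤ n))) (IQ⁺⊩numeral-herTame n))

IQ⁺⊩reading : ∀ φ → IQ⁺⁺ φ → IQ⁺ ⊩ Hereditary.reading φ
IQ⁺⊩reading φ (base (base (iq≤ n))) = IQ⁺⊩reading-iq≤ n
IQ⁺⊩reading φ (base (base iq1))     = ⊩-axiom (base iq1)
IQ⁺⊩reading φ (base (base iq2))     = ⊩-axiom (base iq2)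
IQ⁺⊩reading φ (base (base iq3))     = ⊩-axiom (base iq3)
IQ⁺⊩reading φ (base (base iq4))     = ⊩-axiom (base iq4)
IQ⁺⊩reading φ (base (base iq5))     = ⊩-axiom (base iq5)
IQ⁺⊩reading φ (base (base iq6))     = ⊩-axiom (base iq6)
IQ⁺⊩reading φ (base +assoc)         = ⊩-axiom +assoc
IQ⁺⊩reading φ (base distrib)        = ⊩-axiom distrib
IQ⁺⊩reading φ (base *assoc)         = ⊩-axiom *assoc
IQ⁺⊩reading φ 0≤                    = ⊩-logical 0≼ₕ
IQ⁺⊩reading φ ≤mono                 = ⊩-logical ≼ₕ-mono

IQ⁺⁺-interpretable-in-IQ⁺ : Interpretable IQ⁺⁺ IQ⁺
IQ⁺⁺-interpretable-in-IQ⁺ = 0 , Hereditary.τ , Hereditary.isInterpretation IQ⁺⊩reading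

mainTheorem13 : MutuallyInterpretable IQ⁺ IQ⁺⁺
mainTheorem13 = IQ⁺-interpretable-in-IQ⁺⁺ , IQ⁺⁺-interpretable-in-IQ⁺
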